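{- Let $G$ be a graph, $\mathcal{W}$ an edge clique cover of $G$, $\{\mathcal{W}_1,\mathcal{W}_2,\mathcal{W}_o\}$ a partition of $\mathcal{W}$ into good parts, and $\Omega=V(G)\setminus V(G,\mathcal{W}_1,\mathcal{W}_2,\mathcal{W}_o)$. Then $$\Omega^2=\bigcup_{\mathcal{W}_i\in\{\mathcal{W}_1,\mathcal{W}_2,\mathcal{W}_o\}}\big(V(G)\setminus V(G,\mathcal{W}_i,\mathcal{W}\setminus\mathcal{W}_i)\big)^2.$$
   Context: Graphs are finite, simple and undirected. For a vertex set $X$, $X^2$ denotes the set of unordered pairs of distinct vertices of $X$ (edge set of the complete graph on $X$). $N(X)$ is the set of vertices outside $X$ adjacent to $X$. A full component of $S$ is a connected component $C$ of $G\setminus S$ with $N(C)=S$; a minimal separator is a set with at least two full components; a block is a vertex set $C$ that is a connected component of $G\setminus N(C)$ with $N(C)$ a minimal separator. An edge clique cover of $G$ is a collection $\mathcal{W}$ of cliques with every edge inside some member. A part is a nonempty $\mathcal{W}'\subseteq\mathcal{W}$; $V(G,\mathcal{W}')=\{v:\{W\in\mathcal{W}:v\in W\}\subseteq\mathcal{W}'\}$; $V(G,\mathcal{W}_1,\dots,\mathcal{W}_p)=V(G,\mathcal{W}_1)\cup\dots\cup V(G,\mathcal{W}_p)$. A part is good if every connected component of $G[V(G,\mathcal{W}')]$ is a block. -}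

module Defs where

open import Level using (0ℓ)
open import Data.Nat using (ℕ)
open import Data.Fin using (Fin)
open import Data.Fin.Subset using (Subset) renaming (_∈_ to _∈ₛ_; _∉_ to _∉ₛ_)
open import Data.Product using (Σ; ∃; ∃-syntax; _×_; _,_)
open import Data.Sum using (_⊎_)
open import Relation.Nullary using (¬_; Dec)
open import Relation.Binary.PropositionalEquality using (_≡_; _≢_)
open import Relation.Unary using (Pred; _∈_; _∉_; _⊆_; _≐_; ∁; _∪_)

record Graph (n : ℕ) : Set₁ where
  field
    Adj    : Fin n → Fin n → Set
    adj?   : ∀ u v → Dec (Adj u v)
    sym    : ∀ {u v} → Adj u v → Adj v u
    irrefl : ∀ {u} → ¬ Adj u u

VSet : ℕ → Set₁
VSet n = Pred (Fin n) 0ℓ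

module _ {n : ℕ} (G : Graph n) where
  open Graph G

  data Reach (X : VSet n) : Fin n → Fin n → Set where
    here : ∀ {u} → u ∈ X → Reach X u u
    step : ∀ {u v w} → Reach X u v → Adj v w → w ∈ X → Reach X u w

  Connected : VSet n → Set
  Connected C = ∀ {u v} → u ∈ C → v ∈ C → Reach C u v

  IsComponent : VSet n → VSet n → Set
  IsComponent X C =
    C ⊆ X × (∃[ v ] v ∈ C) × Connected C ×
    (∀ {u w} → u ∈ C → w ∈ X → Adj u w → w ∈ C)

  N : VSet n → VSet n
  N X v = v ∉ X × ∃[ u ] (u ∈ X × Adj u v)

  IsFullComponent : VSet n → VSet n → Set
  IsFullComponent S C = IsComponent (∁ S) C × N C ≐ S

  IsMinimalSeparator : VSet n → Set₁
  IsMinimalSeparator S =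
    ∃[ C₁ ] ∃[ C₂ ] (IsFullComponent S C₁ × IsFullComponent S C₂ × ¬ (C₁ ≐ C₂))

  IsBlock : VSet n → Set₁
  IsBlock C = IsComponent (∁ (N C)) C × IsMinimalSeparator (N C)

  IsClique : Subset n → Set
  IsClique K = ∀ {u v} → u ∈ₛ K → v ∈ₛ K → u ≢ v → Adj u v

  IsEdgeCliqueCover : {m : ℕ} → (Fin m → Subset n) → Set
  IsEdgeCliqueCover {m} W =
    (∀ i → IsClique (W i)) ×
    (∀ {u v} → Adj u v → ∃[ i ] (u ∈ₛ W i × v ∈ₛ W i))

  -- V(G, W') for a part W' ⊆ W (given as a subset of the index set)
  Vp : {m : ℕ} → (Fin m → Subset n) → Subset m → VSet n
  Vp W W' v = ∀ i → v ∈ₛ W i → i ∈ₛ W'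

  IsPart : {m : ℕ} → Subset m → Set
  IsPart W' = ∃[ i ] i ∈ₛ W'

  IsGood : {m : ℕ} → (Fin m → Subset n) → Subset m → Set₁
  IsGood W W' = IsPart W' × (∀ C → IsComponent (Vp W W') C → IsBlock C)

IsPartition3 : {m : ℕ} → Subset m → Subset m → Subset m → Set
IsPartition3 {m} A B C =
  ∀ (i : Fin m) →
    (i ∈ₛ A × i ∉ₛ B × i ∉ₛ C) ⊎
    (i ∉ₛ A × i ∈ₛ B × i ∉ₛ C) ⊎
    (i ∉ₛ A × i ∉ₛ B × i ∈ₛ C)

module Submission where

-- For a vertex x write T(x) = {i : x ∈ W i}; then x ∈ V(G,A)
-- exactly when T(x) ⊆ A.  Relative to the partition {A,B,C} of the index set,
-- x lies in Ω (outside V(G,A) ∪ V(G,B) ∪ V(G,C)) iff T(x) meets at least two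
-- parts, and x lies outside V(G,A) ∪ V(G,W∖A) ("x straddles A") iff T(x)
-- meets both A and its complement.  The identity is therefore a statement
-- about the index sets only.

open import Defs
open import Data.Nat using (ℕ)
open import Data.Fin using (Fin)
open import Data.Fin.Subset using (Subset; ∁; _⊆_) renaming (_∈_ to _∈ₛ_)
open import Data.Fin.Subset.Properties using (x∈∁p⇒x∉p; x∉p⇒x∈∁p; _∈?_)
open import Data.Fin.Properties using (all?)
open import Data.Product using (_×_; _,_; proj₁; swap)
open import Data.Sum using (_⊎_; inj₁; inj₂)
import Data.Sum as Sum
open import Relation.Binary.PropositionalEquality using (_≢_)
open import Relation.Unary using (_∉_; _∪_)
open import Relation.Nullary using (Dec; yes; no; ¬_)
open import Relation.Nullary.Decidable using (_→-dec_)
open import Relation.Nullary.Negation using (contradiction)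
open import Function.Bundles using (_⇔_; mk⇔)

partition-rotate : ∀ {m} {A B C : Subset m} → IsPartition3 A B C → IsPartition3 B C A
partition-rotate P i with P i
... | inj₁ (a , b , c)         = inj₂ (inj₂ (b , c , a))
... | inj₂ (inj₁ (a , b , c))  = inj₁ (b , c , a)
... | inj₂ (inj₂ (a , b , c))  = inj₂ (inj₁ (b , c , a))

partition-swap : ∀ {m} {A B C : Subset m} → IsPartition3 A B C → IsPartition3 A C B
partition-swap P i with P i
... | inj₁ (a , b , c)         = inj₁ (a , c , b)
... | inj₂ (inj₁ (a , b , c))  = inj₂ (inj₂ (a , c , b))
... | inj₂ (inj₂ (a , b , c))  = inj₂ (inj₁ (a , c , b))

partition-disjoint : ∀ {m} {A B C : Subset m} → IsPartition3 A B C → B ⊆ ∁ A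
partition-disjoint P {i} i∈B with P i
... | inj₁ (_ , i∉B , _)       = contradiction i∈B i∉B
... | inj₂ (inj₁ (i∉A , _ , _)) = x∉p⇒x∈∁p i∉A
... | inj₂ (inj₂ (i∉A , _ , _)) = x∉p⇒x∈∁p i∉A

partition-cover : ∀ {m} {A B C : Subset m} {i : Fin m} →
  IsPartition3 A B C → i ∈ₛ ∁ A → i ∈ₛ ∁ B → i ∈ₛ C
partition-cover {i = i} P i∈∁A i∈∁B with P i
... | inj₁ (i∈A , _ , _)        = contradiction i∈A (x∈∁p⇒x∉p i∈∁A)
... | inj₂ (inj₁ (_ , i∈B , _)) = contradiction i∈B (x∈∁p⇒x∉p i∈∁B)
... | inj₂ (inj₂ (_ , _ , i∈C)) = i∈C

module _ {n m : ℕ} (G : Graph n) (W : Fin m → Subset n) where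

  Vp-mono : ∀ {A B : Subset m} {x} → A ⊆ B → Vp G W A x → Vp G W B x
  Vp-mono A⊆B x∈VA i x∈Wi = A⊆B (x∈VA i x∈Wi)

  Vp? : ∀ (A : Subset m) x → Dec (Vp G W A x)
  Vp? A x = all? (λ i → (x ∈? W i) →-dec (i ∈? A))

  Straddles : Subset m → Fin n → Set
  Straddles A x = x ∉ (Vp G W A ∪ Vp G W (∁ A))

  Outside : Subset m → Subset m → Subset m → Fin n → Set
  Outside A B C x = ¬ Vp G W A x × ¬ Vp G W B x × ¬ Vp G W C x

  outside-rotate : ∀ {A B C x} → Outside A B C x → Outside B C A x
  outside-rotate (a , b , c) = b , c , a

  outside-swap : ∀ {A B C x} → Outside A B C x → Outside A C B x
  outside-swap (a , b , c) = a , c , b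

  straddles-intro : ∀ {A x} → ¬ Vp G W A x → ¬ Vp G W (∁ A) x → Straddles A x
  straddles-intro x∉VA _     (inj₁ x∈VA)  = x∉VA x∈VA
  straddles-intro _    x∉V∁A (inj₂ x∈V∁A) = x∉V∁A x∈V∁A

  -- (⊇) A vertex straddling the part A lies in Ω: membership in V(G,B) or
  -- V(G,C) would put it in V(G, W ∖ A).
  straddles⇒outside : ∀ {A B C x} → IsPartition3 A B C → Straddles A x → Outside A B C x
  straddles⇒outside P s =
      (λ x∈VA → s (inj₁ x∈VA))
    , (λ x∈VB → s (inj₂ (Vp-mono (partition-disjoint P) x∈VB)))
    , (λ x∈VC → s (inj₂ (Vp-mono (partition-disjoint (partition-swap P)) x∈VC)))

  -- A vertex of Ω inside V(G, W ∖ A) straddles B: otherwise it would lie in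
  -- V(G, W ∖ B) as well, hence in V(G,C).
  co-part⇒straddles : ∀ {A B C x} → IsPartition3 A B C → Outside A B C x →
    Vp G W (∁ A) x → Straddles B x
  co-part⇒straddles P (_ , x∉VB , x∉VC) x∈V∁A = straddles-intro x∉VB λ x∈V∁B →
    x∉VC λ i x∈Wi → partition-cover P (x∈V∁A i x∈Wi) (x∈V∁B i x∈Wi)

  BothStraddle : Subset m → Fin n → Fin n → Set
  BothStraddle A x y = Straddles A x × Straddles A y

  -- If x ∈ Ω lies in V(G, W ∖ A), it straddles both B and C, and any y ∈ Ω
  -- straddles B unless it lies in V(G, W ∖ B), in which case it straddles C.
  common-straddle-off-A : ∀ {A B C x y} → IsPartition3 A B C →
    Outside A B C x → Outside A B C y → Vp G W (∁ A) x →
    BothStraddle B x y ⊎ BothStraddle C x y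
  common-straddle-off-A {B = B} {y = y} P Ωx Ωy@(_ , y∉VB , _) x∈V∁A with Vp? (∁ B) y
  ... | no y∉V∁B = inj₁ (co-part⇒straddles P Ωx x∈V∁A , straddles-intro y∉VB y∉V∁B)
  ... | yes y∈V∁B = inj₂
    ( co-part⇒straddles (partition-swap P) (outside-swap Ωx) x∈V∁A
    , co-part⇒straddles (partition-rotate P) (outside-rotate Ωy) y∈V∁B )

  common-straddled-part : ∀ {A B C x y} → IsPartition3 A B C →
    Outside A B C x → Outside A B C y →
    BothStraddle A x y ⊎ BothStraddle B x y ⊎ BothStraddle C x y
  common-straddled-part {A = A} {x = x} {y} P Ωx Ωy with Vp? (∁ A) x | Vp? (∁ A) y
  ... | yes x∈V∁A | _ = inj₂ (common-straddle-off-A P Ωx Ωy x∈V∁A)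
  ... | no _ | yes y∈V∁A = inj₂ (Sum.map swap swap (common-straddle-off-A P Ωy Ωx y∈V∁A))
  ... | no x∉V∁A | no y∉V∁A =
    inj₁ (straddles-intro (proj₁ Ωx) x∉V∁A , straddles-intro (proj₁ Ωy) y∉V∁A)

  outside⇒∉union : ∀ {A B C x} → Outside A B C x → x ∉ (Vp G W A ∪ Vp G W B ∪ Vp G W C)
  outside⇒∉union (a , _ , _) (inj₁ x∈VA)         = a x∈VA
  outside⇒∉union (_ , b , _) (inj₂ (inj₁ x∈VB)) = b x∈VB
  outside⇒∉union (_ , _ , c) (inj₂ (inj₂ x∈VC)) = c x∈VC

  ∉union⇒outside : ∀ {A B C x} → x ∉ (Vp G W A ∪ Vp G W B ∪ Vp G W C) → Outside A B C x
  ∉union⇒outside x∉ = (λ a → x∉ (inj₁ a)) , (λ b → x∉ (inj₂ (inj₁ b))) , (λ c → x∉ (inj₂ (inj₂ c)))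

-- Lemma 28.
lemma28 : ∀ {n m} (G : Graph n) (W : Fin m → Subset n) (W₁ W₂ Wₒ : Subset m) →
    IsEdgeCliqueCover G W →
    IsPartition3 W₁ W₂ Wₒ →
    IsGood G W W₁ → IsGood G W W₂ → IsGood G W Wₒ →
    ∀ (u v : Fin n) → u ≢ v →
    ((u ∉ (Vp G W W₁ ∪ Vp G W W₂ ∪ Vp G W Wₒ) × v ∉ (Vp G W W₁ ∪ Vp G W W₂ ∪ Vp G W Wₒ))
    ⇔
    ((u ∉ (Vp G W W₁ ∪ Vp G W (∁ W₁)) × v ∉ (Vp G W W₁ ∪ Vp G W (∁ W₁)))
    ⊎ (u ∉ (Vp G W W₂ ∪ Vp G W (∁ W₂)) × v ∉ (Vp G W W₂ ∪ Vp G W (∁ W₂)))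
    ⊎ (u ∉ (Vp G W Wₒ ∪ Vp G W (∁ Wₒ)) × v ∉ (Vp G W Wₒ ∪ Vp G W (∁ Wₒ)))))
lemma28 G W W₁ W₂ Wₒ _ P _ _ _ u v _ = mk⇔
  (λ (u∈Ω , v∈Ω) → common-straddled-part G W P (∉union⇒outside G W u∈Ω) (∉union⇒outside G W v∈Ω))
  λ { (inj₁ (su , sv))        → outside⇒∉union G W (from₁ su) , outside⇒∉union G W (from₁ sv)
    ; (inj₂ (inj₁ (su , sv))) → outside⇒∉union G W (from₂ su) , outside⇒∉union G W (from₂ sv)
    ; (inj₂ (inj₂ (su , sv))) → outside⇒∉union G W (fromₒ su) , outside⇒∉union G W (fromₒ sv) }
  where
  from₁ : ∀ {x} → Straddles G W W₁ x → Outside G W W₁ W₂ Wₒ x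
  from₁ = straddles⇒outside G W P
  from₂ : ∀ {x} → Straddles G W W₂ x → Outside G W W₁ W₂ Wₒ x
  from₂ s = outside-rotate G W (outside-rotate G W (straddles⇒outside G W (partition-rotate P) s))
  fromₒ : ∀ {x} → Straddles G W Wₒ x → Outside G W W₁ W₂ Wₒ x
  fromₒ s = outside-rotate G W (straddles⇒outside G W (partition-rotate (partition-rotate P)) s)
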